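{- Let $\mathbb{F}$ be a field and assume the matrix space $\mathcal{B}\leq M(n,\mathbb{F})$ contains a nonsingular matrix $S$. Then $\mathcal{B}$ is triangularizable over $\mathbb{F}$ if and only if there exists a nonsingular matrix $D\in M(n,\mathbb{F})$ such that $D^{ -1}\mathcal{B}S^{ -1}D$ consists of upper triangular matrices.
   Context: $\mathcal{B}$ is triangularizable over $\mathbb{F}$ if there exist nonsingular $C,D\in M(n,\mathbb{F})$ such that $D^{ -1}BC$ is upper triangular for every $B\in\mathcal{B}$. $D^{ -1}\mathcal{B}S^{ -1}D=\{D^{ -1}BS^{ -1}D:B\in\mathcal{B}\}$. -}

module Defs where

open import Level using (Level; _⊔_)
open import Algebra.Bundles using (CommutativeRing)
open import Data.Nat using (ℕ; zero; suc)
open import Data.Fin using (Fin; zero; suc; _<_)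
open import Data.Product using (Σ; ∃; _×_)
open import Relation.Nullary using (¬_)

record Field (c ℓ : Level) : Set (Level.suc (c ⊔ ℓ)) where
  field
    commutativeRing : CommutativeRing c ℓ
  open CommutativeRing commutativeRing public
  field
    0≉1     : ¬ (0# ≈ 1#)
    inverse : ∀ x → ¬ (x ≈ 0#) → ∃ λ y → x * y ≈ 1#

module MatrixDefs {c ℓ : Level} (F : Field c ℓ) where
  open Field F using (Carrier; _≈_; _+_; _*_; 0#; 1#)

  Matrix : ℕ → Set c
  Matrix n = Fin n → Fin n → Carrier

  ∑ : ∀ {n} → (Fin n → Carrier) → Carrier
  ∑ {zero}  f = 0#
  ∑ {suc n} f = f zero + ∑ (λ i → f (suc i))

  _≈ᴹ_ : ∀ {n} → Matrix n → Matrix n → Set ℓ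
  A ≈ᴹ B = ∀ i j → A i j ≈ B i j

  _+ᴹ_ : ∀ {n} → Matrix n → Matrix n → Matrix n
  (A +ᴹ B) i j = A i j + B i j

  _·ᴹ_ : ∀ {n} → Carrier → Matrix n → Matrix n
  (a ·ᴹ A) i j = a * A i j

  0ᴹ : ∀ {n} → Matrix n
  0ᴹ i j = 0#

  _*ᴹ_ : ∀ {n} → Matrix n → Matrix n → Matrix n
  (A *ᴹ B) i j = ∑ (λ k → A i k * B k j)

  Iᴹ : ∀ {n} → Matrix n
  Iᴹ {suc n} zero    zero    = 1#
  Iᴹ {suc n} zero    (suc j) = 0#
  Iᴹ {suc n} (suc i) zero    = 0#
  Iᴹ {suc n} (suc i) (suc j) = Iᴹ {n} i j

  IsInverse : ∀ {n} → Matrix n → Matrix n → Set ℓ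
  IsInverse A A' = (A *ᴹ A') ≈ᴹ Iᴹ × (A' *ᴹ A) ≈ᴹ Iᴹ

  Nonsingular : ∀ {n} → Matrix n → Set (c ⊔ ℓ)
  Nonsingular A = ∃ λ A' → IsInverse A A'

  UpperTriangular : ∀ {n} → Matrix n → Set ℓ
  UpperTriangular A = ∀ i j → j < i → A i j ≈ 0#

  record IsMatrixSpace {p} {n : ℕ} (𝓑 : Matrix n → Set p) : Set (c ⊔ ℓ ⊔ p) where
    field
      respects : ∀ {A B} → A ≈ᴹ B → 𝓑 A → 𝓑 B
      has-0    : 𝓑 0ᴹ
      +-closed : ∀ {A B} → 𝓑 A → 𝓑 B → 𝓑 (A +ᴹ B)
      ·-closed : ∀ a {A} → 𝓑 A → 𝓑 (a ·ᴹ A)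

  Triangularizable : ∀ {p} {n} → (Matrix n → Set p) → Set (c ⊔ ℓ ⊔ p)
  Triangularizable {n = n} 𝓑 =
    Σ (Matrix n) λ C → Nonsingular C ×
    Σ (Matrix n) λ D → Σ (Matrix n) λ D⁻¹ → IsInverse D D⁻¹ ×
      (∀ B → 𝓑 B → UpperTriangular ((D⁻¹ *ᴹ B) *ᴹ C))

-- If D⁻¹ B C is upper triangular for all B ∈ 𝓑, then so is T := D⁻¹ S C, and T is
-- invertible with inverse C⁻¹ S⁻¹ D. The inverse of an invertible upper triangular
-- matrix is upper triangular, so D⁻¹ B S⁻¹ D = (D⁻¹ B C)(C⁻¹ S⁻¹ D) is a product of
-- upper triangular matrices. Conversely, take C := S⁻¹ D.
module Submission where

open import Defs
open import Level using (Level; _⊔_)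
open import Data.Nat as ℕ using (ℕ)
import Data.Nat.Properties as ℕ
open import Data.Fin using (Fin; zero; suc; _<_; _≤_)
open import Data.Fin.Properties using (_<?_; <-cmp; suc-injective)
open import Data.Fin.Induction using (<-wellFounded)
open import Data.Product using (Σ; _×_; _,_; proj₁; proj₂)
open import Function using (_∘_)
open import Function.Bundles using (_⇔_; mk⇔)
open import Induction.WellFounded using (WfRec; module All)
open import Relation.Binary.Bundles using (Setoid)
open import Relation.Binary.Definitions using (tri<; tri≈; tri>)
open import Relation.Binary.PropositionalEquality as ≡ using (_≢_; refl; cong)
open import Relation.Nullary using (yes; no; contradiction)
open import Relation.Unary using (Pred)
import Relation.Binary.Reasoning.Setoid as SetoidReasoning

module Triangular {c ℓ : Level} (F : Field c ℓ) where
  open MatrixDefs F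
  open Field F hiding (zero; refl)
  open Field F using () renaming (refl to ≈-refl)
  open import Algebra.Properties.Semiring.Sum semiring
    using (sum; sum-cong-≋; sum-replicate-zero; *-distribˡ-sum; *-distribʳ-sum; ∑-comm)

  -- ∑ and the library's sum unfold alike but are distinct recursive definitions,
  -- so the library's summation lemmas are transported along this.
  ∑≈sum : ∀ {n} (f : Fin n → Carrier) → ∑ f ≈ sum f
  ∑≈sum {ℕ.zero}  f = ≈-refl
  ∑≈sum {ℕ.suc n} f = +-congˡ (∑≈sum (f ∘ suc))

  ∑-cong : ∀ {n} {f g : Fin n → Carrier} → (∀ k → f k ≈ g k) → ∑ f ≈ ∑ g
  ∑-cong {f = f} {g} f≈g = trans (∑≈sum f) (trans (sum-cong-≋ f≈g) (sym (∑≈sum g)))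

  ∑-zero : ∀ {n} {f : Fin n → Carrier} → (∀ k → f k ≈ 0#) → ∑ f ≈ 0#
  ∑-zero {n} {f} f≈0 = trans (∑≈sum f) (trans (sum-cong-≋ f≈0) (sum-replicate-zero n))

  ∑-distribˡ : ∀ {n} x (f : Fin n → Carrier) → x * ∑ f ≈ ∑ (λ k → x * f k)
  ∑-distribˡ x f = trans (*-congˡ (∑≈sum f)) (trans (*-distribˡ-sum x f) (sym (∑≈sum (λ k → x * f k))))

  ∑-distribʳ : ∀ {n} x (f : Fin n → Carrier) → ∑ f * x ≈ ∑ (λ k → f k * x)
  ∑-distribʳ x f = trans (*-congʳ (∑≈sum f)) (trans (*-distribʳ-sum x f) (sym (∑≈sum (λ k → f k * x))))

  ∑-swap : ∀ {m n} (f : Fin m → Fin n → Carrier) →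
           ∑ (λ i → ∑ (λ j → f i j)) ≈ ∑ (λ j → ∑ (λ i → f i j))
  ∑-swap f = trans (∑∑≈sumsum f) (trans (∑-comm f) (sym (∑∑≈sumsum (λ j i → f i j))))
    where
    ∑∑≈sumsum : ∀ {m n} (g : Fin m → Fin n → Carrier) →
                ∑ (λ i → ∑ (g i)) ≈ sum (λ i → sum (g i))
    ∑∑≈sumsum g = trans (∑≈sum (λ i → ∑ (g i))) (sum-cong-≋ (λ i → ∑≈sum (g i)))

  ∑-single : ∀ {n} {f : Fin n → Carrier} (j : Fin n) →
             (∀ k → k ≢ j → f k ≈ 0#) → ∑ f ≈ f j
  ∑-single {f = f} zero others≈0 =
    trans (+-congˡ (∑-zero (λ k → others≈0 (suc k) λ ()))) (+-identityʳ (f zero))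
  ∑-single {f = f} (suc j) others≈0 =
    trans (+-cong (others≈0 zero λ ())
                  (∑-single j λ k k≢j → others≈0 (suc k) (k≢j ∘ suc-injective)))
          (+-identityˡ (f (suc j)))

  ≈ᴹ-setoid : ℕ → Setoid c ℓ
  ≈ᴹ-setoid n = record
    { Carrier       = Matrix n
    ; _≈_           = _≈ᴹ_
    ; isEquivalence = record
      { refl  = λ i j → ≈-refl
      ; sym   = λ A≈B i j → sym (A≈B i j)
      ; trans = λ A≈B B≈C i j → trans (A≈B i j) (B≈C i j)
      }
    }

  open module ≈ᴹ {n} = Setoid (≈ᴹ-setoid n)
    using () renaming (refl to ≈ᴹ-refl; sym to ≈ᴹ-sym; trans to ≈ᴹ-trans)

  *ᴹ-cong : ∀ {n} {A A′ B B′ : Matrix n} → A ≈ᴹ A′ → B ≈ᴹ B′ → (A *ᴹ B) ≈ᴹ (A′ *ᴹ B′)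
  *ᴹ-cong A≈A′ B≈B′ i j = ∑-cong (λ k → *-cong (A≈A′ i k) (B≈B′ k j))

  *ᴹ-assoc : ∀ {n} (A B C : Matrix n) → ((A *ᴹ B) *ᴹ C) ≈ᴹ (A *ᴹ (B *ᴹ C))
  *ᴹ-assoc A B C i j = begin
    ∑ (λ k → ∑ (λ l → A i l * B l k) * C k j)    ≈⟨ ∑-cong (λ k → ∑-distribʳ (C k j) (λ l → A i l * B l k)) ⟩
    ∑ (λ k → ∑ (λ l → (A i l * B l k) * C k j))  ≈⟨ ∑-swap (λ k l → (A i l * B l k) * C k j) ⟩
    ∑ (λ l → ∑ (λ k → (A i l * B l k) * C k j))  ≈⟨ ∑-cong (λ l → ∑-cong (λ k → *-assoc (A i l) (B l k) (C k j))) ⟩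
    ∑ (λ l → ∑ (λ k → A i l * (B l k * C k j)))  ≈⟨ ∑-cong (λ l → sym (∑-distribˡ (A i l) (λ k → B l k * C k j))) ⟩
    ∑ (λ l → A i l * ∑ (λ k → B l k * C k j))    ∎
    where open SetoidReasoning setoid

  Iᴹ-diagonal : ∀ {n} (i : Fin n) → Iᴹ i i ≈ 1#
  Iᴹ-diagonal zero    = ≈-refl
  Iᴹ-diagonal (suc i) = Iᴹ-diagonal i

  Iᴹ-offDiagonal : ∀ {n} (i j : Fin n) → i ≢ j → Iᴹ i j ≈ 0#
  Iᴹ-offDiagonal zero    zero    i≢j = contradiction refl i≢j
  Iᴹ-offDiagonal zero    (suc j) i≢j = ≈-refl
  Iᴹ-offDiagonal (suc i) zero    i≢j = ≈-refl
  Iᴹ-offDiagonal (suc i) (suc j) i≢j = Iᴹ-offDiagonal i j (λ i≡j → i≢j (cong suc i≡j))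

  *ᴹ-identityˡ : ∀ {n} (A : Matrix n) → (Iᴹ *ᴹ A) ≈ᴹ A
  *ᴹ-identityˡ A i j =
    trans (∑-single i λ k k≢i → trans (*-congʳ (Iᴹ-offDiagonal i k (k≢i ∘ ≡.sym)))
                                      (zeroˡ _))
          (trans (*-congʳ (Iᴹ-diagonal i)) (*-identityˡ _))

  *ᴹ-cancel-inner : ∀ {n} (X A A′ Y : Matrix n) → (A *ᴹ A′) ≈ᴹ Iᴹ →
                    ((X *ᴹ A) *ᴹ (A′ *ᴹ Y)) ≈ᴹ (X *ᴹ Y)
  *ᴹ-cancel-inner X A A′ Y AA′≈I = begin
    (X *ᴹ A) *ᴹ (A′ *ᴹ Y)  ≈⟨ *ᴹ-assoc X A (A′ *ᴹ Y) ⟩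
    X *ᴹ (A *ᴹ (A′ *ᴹ Y))  ≈⟨ *ᴹ-cong ≈ᴹ-refl (≈ᴹ-sym (*ᴹ-assoc A A′ Y)) ⟩
    X *ᴹ ((A *ᴹ A′) *ᴹ Y)  ≈⟨ *ᴹ-cong ≈ᴹ-refl (*ᴹ-cong AA′≈I ≈ᴹ-refl) ⟩
    X *ᴹ (Iᴹ *ᴹ Y)         ≈⟨ *ᴹ-cong ≈ᴹ-refl (*ᴹ-identityˡ Y) ⟩
    X *ᴹ Y                 ∎
    where open SetoidReasoning (≈ᴹ-setoid _)

  IsInverse-sym : ∀ {n} {A A′ : Matrix n} → IsInverse A A′ → IsInverse A′ A
  IsInverse-sym (AA′≈I , A′A≈I) = A′A≈I , AA′≈I

  IsInverse-*ᴹ : ∀ {n} {A A′ B B′ : Matrix n} → IsInverse A A′ → IsInverse B B′ →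
                 IsInverse (A *ᴹ B) (B′ *ᴹ A′)
  IsInverse-*ᴹ {A = A} {A′} {B} {B′} (AA′≈I , A′A≈I) (BB′≈I , B′B≈I) =
    ≈ᴹ-trans (*ᴹ-cancel-inner A B B′ A′ BB′≈I) AA′≈I ,
    ≈ᴹ-trans (*ᴹ-cancel-inner B′ A′ A B A′A≈I) B′B≈I

  UpperTriangular-resp : ∀ {n} {A B : Matrix n} → A ≈ᴹ B → UpperTriangular A → UpperTriangular B
  UpperTriangular-resp A≈B A-ut i j j<i = trans (sym (A≈B i j)) (A-ut i j j<i)

  UpperTriangular-*ᴹ : ∀ {n} {A B : Matrix n} → UpperTriangular A → UpperTriangular B →
                       UpperTriangular (A *ᴹ B)
  UpperTriangular-*ᴹ {A = A} {B} A-ut B-ut i j j<i = ∑-zero term≈0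
    where
    term≈0 : ∀ k → A i k * B k j ≈ 0#
    term≈0 k with k <? i
    ... | yes k<i = trans (*-congʳ (A-ut i k k<i)) (zeroˡ _)
    ... | no  k≮i = trans (*-congˡ (B-ut k j (ℕ.<-≤-trans j<i (ℕ.≮⇒≥ k≮i)))) (zeroʳ _)

  -- Column by column (well-founded induction on j): below the diagonal, the j-th
  -- column of U T is U i j * T j j, since the columns k < j of U already vanish there.
  UpperTriangular-leftInverse : ∀ {n} {T U : Matrix n} → UpperTriangular T →
                                (U *ᴹ T) ≈ᴹ Iᴹ → UpperTriangular U
  UpperTriangular-leftInverse {n} {T} {U} T-ut UT≈I i j =
    All.wfRec <-wellFounded ℓ ColumnVanishes column-vanishes j i
    where
    ColumnVanishes : Pred (Fin n) ℓ
    ColumnVanishes j = ∀ i → j < i → U i j ≈ 0#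

    column-vanishes : ∀ j → WfRec _<_ ColumnVanishes j → ColumnVanishes j
    column-vanishes j earlier i j<i = begin
      U i j                      ≈⟨ sym (*-identityʳ _) ⟩
      U i j * 1#                 ≈⟨ *-congˡ (sym pivot) ⟩
      U i j * (U j j * T j j)    ≈⟨ *-congˡ (*-comm _ _) ⟩
      U i j * (T j j * U j j)    ≈⟨ sym (*-assoc _ _ _) ⟩
      (U i j * T j j) * U j j    ≈⟨ *-congʳ below-pivot ⟩
      0# * U j j                 ≈⟨ zeroˡ _ ⟩
      0#                         ∎
      where
      open SetoidReasoning setoid

      entry : ∀ r → j ≤ r → (U *ᴹ T) r j ≈ U r j * T j j
      entry r j≤r = ∑-single j term≈0
        where
        term≈0 : ∀ k → k ≢ j → U r k * T k j ≈ 0#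
        term≈0 k k≢j with <-cmp k j
        ... | tri< k<j _ _ = trans (*-congʳ (earlier k<j r (ℕ.<-≤-trans k<j j≤r))) (zeroˡ _)
        ... | tri≈ _ k≡j _ = contradiction k≡j k≢j
        ... | tri> _ _ j<k = trans (*-congˡ (T-ut k j j<k)) (zeroʳ _)

      pivot : U j j * T j j ≈ 1#
      pivot = trans (sym (entry j ℕ.≤-refl)) (trans (UT≈I j j) (Iᴹ-diagonal j))

      below-pivot : U i j * T j j ≈ 0#
      below-pivot = trans (sym (entry i (ℕ.<⇒≤ j<i)))
                          (trans (UT≈I i j) (Iᴹ-offDiagonal i j (λ { refl → ℕ.<-irrefl refl j<i })))

  UpperTriangular-replaceRightFactor :
    ∀ {n} {B S S⁻¹ C C⁻¹ D D⁻¹ : Matrix n} →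
    IsInverse S S⁻¹ → IsInverse C C⁻¹ → IsInverse D D⁻¹ →
    UpperTriangular ((D⁻¹ *ᴹ S) *ᴹ C) → UpperTriangular ((D⁻¹ *ᴹ B) *ᴹ C) →
    UpperTriangular (((D⁻¹ *ᴹ B) *ᴹ S⁻¹) *ᴹ D)
  UpperTriangular-replaceRightFactor {B = B} {S} {S⁻¹} {C} {C⁻¹} {D} {D⁻¹}
                                     S-inv C-inv D-inv T-ut BC-ut =
    UpperTriangular-resp BC·T⁻¹≈BS⁻¹D (UpperTriangular-*ᴹ BC-ut T⁻¹-ut)
    where
    T-inv : IsInverse ((D⁻¹ *ᴹ S) *ᴹ C) (C⁻¹ *ᴹ (S⁻¹ *ᴹ D))
    T-inv = IsInverse-*ᴹ (IsInverse-*ᴹ (IsInverse-sym D-inv) S-inv) C-inv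

    T⁻¹-ut : UpperTriangular (C⁻¹ *ᴹ (S⁻¹ *ᴹ D))
    T⁻¹-ut = UpperTriangular-leftInverse T-ut (proj₂ T-inv)

    BC·T⁻¹≈BS⁻¹D : (((D⁻¹ *ᴹ B) *ᴹ C) *ᴹ (C⁻¹ *ᴹ (S⁻¹ *ᴹ D))) ≈ᴹ (((D⁻¹ *ᴹ B) *ᴹ S⁻¹) *ᴹ D)
    BC·T⁻¹≈BS⁻¹D = ≈ᴹ-trans (*ᴹ-cancel-inner (D⁻¹ *ᴹ B) C C⁻¹ (S⁻¹ *ᴹ D) (proj₁ C-inv))
                            (≈ᴹ-sym (*ᴹ-assoc (D⁻¹ *ᴹ B) S⁻¹ D))

lemma10 : {c ℓ p : Level} (F : Field c ℓ) (n : ℕ) →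
    let open MatrixDefs F in
    (𝓑 : Matrix n → Set p) → IsMatrixSpace 𝓑 →
    (S S⁻¹ : Matrix n) → IsInverse S S⁻¹ → 𝓑 S →
    Triangularizable 𝓑 ⇔
    (Σ (Matrix n) λ D → Σ (Matrix n) λ D⁻¹ → IsInverse D D⁻¹ ×
    (∀ B → 𝓑 B → UpperTriangular (((D⁻¹ *ᴹ B) *ᴹ S⁻¹) *ᴹ D)))
lemma10 {c} {ℓ} {p} F n 𝓑 _ S S⁻¹ S-inv S∈𝓑 = mk⇔ to from
  where
  open MatrixDefs F
  open Triangular F

  TriangularizedBy-S⁻¹ : Set (c ⊔ ℓ ⊔ p)
  TriangularizedBy-S⁻¹ =
    Σ (Matrix n) λ D → Σ (Matrix n) λ D⁻¹ → IsInverse D D⁻¹ ×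
      (∀ B → 𝓑 B → UpperTriangular (((D⁻¹ *ᴹ B) *ᴹ S⁻¹) *ᴹ D))

  to : Triangularizable 𝓑 → TriangularizedBy-S⁻¹
  to (C , (C⁻¹ , C-inv) , D , D⁻¹ , D-inv , triangular) =
    D , D⁻¹ , D-inv , λ B B∈𝓑 →
      UpperTriangular-replaceRightFactor S-inv C-inv D-inv
        (triangular S S∈𝓑) (triangular B B∈𝓑)

  from : TriangularizedBy-S⁻¹ → Triangularizable 𝓑
  from (D , D⁻¹ , D-inv , triangular) =
    S⁻¹ *ᴹ D , (D⁻¹ *ᴹ S , IsInverse-*ᴹ (IsInverse-sym S-inv) D-inv) , D , D⁻¹ , D-inv ,
    λ B B∈𝓑 → UpperTriangular-resp (*ᴹ-assoc (D⁻¹ *ᴹ B) S⁻¹ D) (triangular B B∈𝓑)
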